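{- Let $k \geq 1$ be an integer. A subset $S \subseteq V(\Omega_{2k})$ is a determining set for $\Omega_{2k}$ if and only if $S$ contains at least one of $\mathbf{u}$, $\mathbf{u}+\mathbf{1}$ for every $\mathbf{u} \in V(\Omega_{2k})$. Consequently $\mathrm{Det}(\Omega_{2k}) = 2^{2k-1}$.
   Context: The orthogonality graph $\Omega_{2k}$ has vertex set $\mathbb{Z}_2^{2k}$, the set of bitstrings $\mathbf{u} = u_1u_2\cdots u_{2k}$ with $u_i\in\{0,1\}$, and two vertices are adjacent if and only if their bitstrings differ in exactly $k$ positions. Addition $\mathbf{u}+\mathbf{w}$ is bitwise modulo 2, and $\mathbf{1}$ denotes the all-ones bitstring. A set $S \subseteq V(G)$ is a determining set for a graph $G$ if the only automorphism of $G$ fixing every vertex of $S$ is the identity (equivalently, every automorphism is uniquely determined by its action on $S$). $\mathrm{Det}(G)$ is the minimum size of a determining set of $G$. -}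

module Defs where

open import Data.Bool using (Bool; true; false; not; _xor_)
open import Data.Nat using (ℕ; zero; suc; _+_; _*_; _∸_; _^_; _≤_)
open import Data.Vec using (Vec; []; _∷_; zipWith; replicate)
open import Data.List using (List; length; filterᵇ; map; _++_; [_])
open import Data.Product using (Σ; _×_; _,_)
open import Data.Sum using (_⊎_)
open import Function.Bundles using (_↔_; Inverse)
open import Relation.Binary.PropositionalEquality using (_≡_)

-- Vertices of Ω_n: bitstrings of length n (n = 2k in the paper).
Bits : ℕ → Set
Bits n = Vec Bool n

dist : ∀ {n} → Bits n → Bits n → ℕ
dist [] [] = 0
dist (a ∷ u) (b ∷ w) = (if' (a xor b)) + dist u w
  where
  if' : Bool → ℕ
  if' true = 1
  if' false = 0

_⊕_ : ∀ {n} → Bits n → Bits n → Bits n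
_⊕_ = zipWith _xor_

𝟏 : ∀ {n} → Bits n
𝟏 = replicate _ true

Adj : (k : ℕ) → Bits (2 * k) → Bits (2 * k) → Set
Adj k u w = dist u w ≡ k

record Aut (k : ℕ) : Set where
  field
    perm : Bits (2 * k) ↔ Bits (2 * k)
  σ : Bits (2 * k) → Bits (2 * k)
  σ = Inverse.to perm
  field
    preserves : ∀ u w → (Adj k u w → Adj k (σ u) (σ w)) × (Adj k (σ u) (σ w) → Adj k u w)

VSubset : ℕ → Set
VSubset k = Bits (2 * k) → Bool

-- membership, with k given explicitly (it cannot be inferred from 2 * k)
Mem : (k : ℕ) → Bits (2 * k) → VSubset k → Set
Mem k u S = S u ≡ true

IsDetermining : (k : ℕ) → VSubset k → Set
IsDetermining k S = (φ : Aut k) → (∀ v → Mem k v S → Aut.σ φ v ≡ v) → ∀ v → Aut.σ φ v ≡ v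

allBits : (n : ℕ) → List (Bits n)
allBits zero = [ [] ]
allBits (suc n) = map (false ∷_) (allBits n) ++ map (true ∷_) (allBits n)

card : (k : ℕ) → VSubset k → ℕ
card k S = length (filterᵇ S (allBits (2 * k)))

DetIs : (k : ℕ) → ℕ → Set
DetIs k d = (Σ (VSubset k) λ S → IsDetermining k S × card k S ≡ d)
          × (∀ S → IsDetermining k S → d ≤ card k S)

-- Since dist (u ⊕ 𝟏) w + dist u w = 2k, the vertices u and u ⊕ 𝟏 have the same neighbourhood;
-- conversely, if the neighbourhood of v is contained in that of w then w ∈ {v, v ⊕ 𝟏}, since
-- otherwise flipping suitable positions of v produces a neighbour of v that is not one of w.
-- Hence every automorphism commutes with u ↦ u ⊕ 𝟏, so fixing one vertex of each antipodal pair
-- fixes everything.  Conversely, complementing every vertex whose antipodal pair misses S is an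
-- automorphism fixing S, and it is the identity only if S meets every pair.  A set meeting every
-- pair has at least 2^(2k-1) elements, and the strings with first bit 0 attain this bound.
module Submission where

open import Defs
open import Data.Bool using (Bool; true; false; not; _∨_)
open import Data.Bool.Properties using (∨-comm)
open import Data.Nat
open import Data.Nat.Properties
open import Algebra.Properties.CommutativeSemigroup +-commutativeSemigroup using (interchange)
open import Data.Vec using ([]; _∷_; head)
open import Data.List using (List; length; filterᵇ; map; _++_)
import Data.List as List
open import Data.List.Properties using (length-++; filter-++)
open import Data.Product using (_×_; _,_; proj₁; proj₂; ∃-syntax)
open import Data.Sum using (_⊎_; inj₁; inj₂)
open import Data.Empty using (⊥-elim)
open import Function using (_∘_; const)
open import Function.Bundles using (_⇔_; Inverse; Injection; Equivalence; mk↔ₛ′; mk⇔)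
open import Function.Properties.Inverse using (Inverse⇒Injection)
import Function.Properties.Equivalence as ⇔
open import Relation.Nullary using (yes; no)
open import Relation.Nullary.Decidable using (T?)
open import Relation.Binary.PropositionalEquality

private
  variable
    n : ℕ

⊕𝟏-involutive : (v : Bits n) → (v ⊕ 𝟏) ⊕ 𝟏 ≡ v
⊕𝟏-involutive []          = refl
⊕𝟏-involutive (false ∷ v) = cong (false ∷_) (⊕𝟏-involutive v)
⊕𝟏-involutive (true ∷ v)  = cong (true ∷_) (⊕𝟏-involutive v)

⊕𝟏-injective : {v w : Bits n} → v ⊕ 𝟏 ≡ w ⊕ 𝟏 → v ≡ w
⊕𝟏-injective {v = v} {w} eq =
  trans (sym (⊕𝟏-involutive v)) (trans (cong (_⊕ 𝟏) eq) (⊕𝟏-involutive w))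

⊕𝟏-fixedPointFree : (v : Bits (suc n)) → v ⊕ 𝟏 ≢ v
⊕𝟏-fixedPointFree (false ∷ _) ()
⊕𝟏-fixedPointFree (true ∷ _)  ()

dist≡0⇒≡ : {v w : Bits n} → dist v w ≡ 0 → v ≡ w
dist≡0⇒≡ {v = []}        {[]}        _  = refl
dist≡0⇒≡ {v = false ∷ v} {false ∷ w} eq = cong (false ∷_) (dist≡0⇒≡ eq)
dist≡0⇒≡ {v = true ∷ v}  {true ∷ w}  eq = cong (true ∷_) (dist≡0⇒≡ eq)

dist-⊕𝟏ˡ : (v w : Bits n) → dist (v ⊕ 𝟏) w ≡ dist v (w ⊕ 𝟏)
dist-⊕𝟏ˡ []          []          = refl
dist-⊕𝟏ˡ (false ∷ v) (false ∷ w) = cong suc (dist-⊕𝟏ˡ v w)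
dist-⊕𝟏ˡ (false ∷ v) (true ∷ w)  = dist-⊕𝟏ˡ v w
dist-⊕𝟏ˡ (true ∷ v)  (false ∷ w) = dist-⊕𝟏ˡ v w
dist-⊕𝟏ˡ (true ∷ v)  (true ∷ w)  = cong suc (dist-⊕𝟏ˡ v w)

dist-⊕𝟏-⊕𝟏 : (v w : Bits n) → dist (v ⊕ 𝟏) (w ⊕ 𝟏) ≡ dist v w
dist-⊕𝟏-⊕𝟏 v w = trans (dist-⊕𝟏ˡ v (w ⊕ 𝟏)) (cong (dist v) (⊕𝟏-involutive w))

dist-⊕𝟏ʳ+dist : (v w : Bits n) → dist v (w ⊕ 𝟏) + dist v w ≡ n
dist-⊕𝟏ʳ+dist []          []          = refl
dist-⊕𝟏ʳ+dist (false ∷ v) (false ∷ w) = cong suc (dist-⊕𝟏ʳ+dist v w)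
dist-⊕𝟏ʳ+dist (false ∷ v) (true ∷ w)  = trans (+-suc _ _) (cong suc (dist-⊕𝟏ʳ+dist v w))
dist-⊕𝟏ʳ+dist (true ∷ v)  (false ∷ w) = trans (+-suc _ _) (cong suc (dist-⊕𝟏ʳ+dist v w))
dist-⊕𝟏ʳ+dist (true ∷ v)  (true ∷ w)  = cong suc (dist-⊕𝟏ʳ+dist v w)

-- dist v (w ⊕ 𝟏) counts the positions where v and w agree; x is v with i of the positions where
-- they differ and j of those where they agree flipped.
vertex-at-distances : (v w : Bits n) {i j : ℕ} → i ≤ dist v w → j ≤ dist v (w ⊕ 𝟏) →
  ∃[ x ] dist v x ≡ i + j × dist w x ≡ dist v w ∸ i + j
vertex-at-distances [] [] z≤n z≤n = [] , refl , refl
vertex-at-distances (false ∷ v) (false ∷ w) {i} {zero} i≤ z≤n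
  with x , p , q ← vertex-at-distances v w i≤ z≤n = false ∷ x , p , q
vertex-at-distances (false ∷ v) (false ∷ w) {i} {suc j} i≤ (s≤s j≤)
  with x , p , q ← vertex-at-distances v w i≤ j≤ =
  true ∷ x , trans (cong suc p) (sym (+-suc i j)) , trans (cong suc q) (sym (+-suc _ j))
vertex-at-distances (true ∷ v) (true ∷ w) {i} {zero} i≤ z≤n
  with x , p , q ← vertex-at-distances v w i≤ z≤n = true ∷ x , p , q
vertex-at-distances (true ∷ v) (true ∷ w) {i} {suc j} i≤ (s≤s j≤)
  with x , p , q ← vertex-at-distances v w i≤ j≤ =
  false ∷ x , trans (cong suc p) (sym (+-suc i j)) , trans (cong suc q) (sym (+-suc _ j))
vertex-at-distances (false ∷ v) (true ∷ w) {zero} z≤n j≤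
  with x , p , q ← vertex-at-distances v w z≤n j≤ = false ∷ x , p , cong suc q
vertex-at-distances (false ∷ v) (true ∷ w) {suc i} (s≤s i≤) j≤
  with x , p , q ← vertex-at-distances v w i≤ j≤ = true ∷ x , cong suc p , q
vertex-at-distances (true ∷ v) (false ∷ w) {zero} z≤n j≤
  with x , p , q ← vertex-at-distances v w z≤n j≤ = true ∷ x , p , cong suc q
vertex-at-distances (true ∷ v) (false ∷ w) {suc i} (s≤s i≤) j≤
  with x , p , q ← vertex-at-distances v w i≤ j≤ = false ∷ x , cong suc p , q

m+n≡o+o⇒m≡o⇔n≡o : ∀ {m n o} → m + n ≡ o + o → m ≡ o ⇔ n ≡ o
m+n≡o+o⇒m≡o⇔n≡o {m} {n} {o} eq = mk⇔
  (λ { refl → +-cancelˡ-≡ o n o eq })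
  (λ { refl → +-cancelʳ-≡ n m o eq })

complementIf : Bool → Bits n → Bits n
complementIf false v = v
complementIf true  v = v ⊕ 𝟏

module HalfDistance {n k : ℕ} (n≡k+k : n ≡ k + k) where

  dist-⊕𝟏ʳ-half : (v w : Bits n) → dist v (w ⊕ 𝟏) ≡ k ⇔ dist v w ≡ k
  dist-⊕𝟏ʳ-half v w = m+n≡o+o⇒m≡o⇔n≡o (trans (dist-⊕𝟏ʳ+dist v w) n≡k+k)

  dist-complementIf-half : ∀ b c (v w : Bits n) →
    dist (complementIf b v) (complementIf c w) ≡ k ⇔ dist v w ≡ k
  dist-complementIf-half false false v w = ⇔.refl
  dist-complementIf-half false true  v w = dist-⊕𝟏ʳ-half v w
  dist-complementIf-half true  false v w rewrite dist-⊕𝟏ˡ v w = dist-⊕𝟏ʳ-half v w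
  dist-complementIf-half true  true  v w rewrite dist-⊕𝟏-⊕𝟏 v w = ⇔.refl

  -- If d = dist v w ≤ k, flip the d differing and k ∸ d agreeing positions of v: the result is
  -- at distance k ∸ d < k from w.  Otherwise flip k differing positions: the result is at distance
  -- d ∸ k from w, which is k only when d = k + k, i.e. when v and w ⊕ 𝟏 agree.
  separating-vertex : (v w : Bits n) → 0 < dist v w → 0 < dist v (w ⊕ 𝟏) →
    ∃[ x ] dist v x ≡ k × dist w x ≢ k
  separating-vertex v w 0<d 0<a with dist v w ≤? k
  ... | yes d≤k =
    let x , vx≡d+[k∸d] , wx≡d∸d+[k∸d] = vertex-at-distances v w {d} {k ∸ d} ≤-refl k∸d≤a
        wx≡k∸d = trans wx≡d∸d+[k∸d] (cong (_+ (k ∸ d)) (n∸n≡0 d))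
    in x , trans vx≡d+[k∸d] (m+[n∸m]≡n d≤k) ,
       λ wx≡k → <-irrefl (trans (sym wx≡k∸d) wx≡k) (∸-monoʳ-< 0<d d≤k)
    where
    d a : ℕ
    d = dist v w
    a = dist v (w ⊕ 𝟏)
    k+d≤a+d : k + d ≤ a + d
    k+d≤a+d = ≤-trans (+-monoʳ-≤ k d≤k) (≤-reflexive (sym (trans (dist-⊕𝟏ʳ+dist v w) n≡k+k)))
    k∸d≤a : k ∸ d ≤ a
    k∸d≤a = ≤-trans (m∸n≤m k d) (+-cancelʳ-≤ d k a k+d≤a+d)
  ... | no d≰k =
    let x , vx≡k+0 , wx≡d∸k+0 = vertex-at-distances v w {k} {0} k≤d z≤n
    in x , trans vx≡k+0 (+-identityʳ k) , λ wx≡k → <-irrefl (a≡0 (trans (sym wx≡d∸k+0) wx≡k)) 0<a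
    where
    d a : ℕ
    d = dist v w
    a = dist v (w ⊕ 𝟏)
    k≤d : k ≤ d
    k≤d = ≤-trans (n≤1+n k) (≰⇒> d≰k)
    a≡0 : d ∸ k + 0 ≡ k → 0 ≡ a
    a≡0 eq = sym (+-cancelʳ-≡ d a 0 (begin
      a + d         ≡⟨ trans (dist-⊕𝟏ʳ+dist v w) n≡k+k ⟩
      k + k         ≡⟨ cong (_+ k) eq ⟨
      d ∸ k + 0 + k ≡⟨ cong (_+ k) (+-identityʳ (d ∸ k)) ⟩
      d ∸ k + k     ≡⟨ m∸n+n≡m k≤d ⟩
      d             ∎))
      where open ≡-Reasoning

  neighbourhood-⊆⇒≡⊎≡⊕𝟏 : (v w : Bits n) → (∀ x → dist v x ≡ k → dist w x ≡ k) →
    w ≡ v ⊎ w ≡ v ⊕ 𝟏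
  neighbourhood-⊆⇒≡⊎≡⊕𝟏 v w N⊆N with dist v w ≟ 0 | dist v (w ⊕ 𝟏) ≟ 0
  ... | yes d≡0 | _       = inj₁ (sym (dist≡0⇒≡ d≡0))
  ... | no _    | yes a≡0 = inj₂ (⊕𝟏-injective (trans (sym (dist≡0⇒≡ a≡0)) (sym (⊕𝟏-involutive v))))
  ... | no d≢0  | no a≢0  =
    let x , vx≡k , wx≢k = separating-vertex v w (n≢0⇒n>0 d≢0) (n≢0⇒n>0 a≢0)
    in ⊥-elim (wx≢k (N⊆N x vx≡k))

2*k≡k+k : ∀ k → 2 * k ≡ k + k
2*k≡k+k k = cong (k +_) (+-identityʳ k)

MeetsEveryAntipodalPair : (Bits n → Bool) → Set
MeetsEveryAntipodalPair S = ∀ u → S u ≡ true ⊎ S (u ⊕ 𝟏) ≡ true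

module _ (k : ℕ) where
  open HalfDistance {k = k} (2*k≡k+k k)

  -- dist (x ⊕ 𝟏) y = k + k ∸ dist x y, so complementing any ⊕ 𝟏-closed set of vertices keeps
  -- adjacency and non-adjacency.
  complementing : (c : Bits (2 * k) → Bool) → (∀ x → c (x ⊕ 𝟏) ≡ c x) → Aut k
  complementing c c-⊕𝟏 = record
    { perm      = mk↔ₛ′ τ τ τ-involutive τ-involutive
    ; preserves = λ u w → let open Equivalence (dist-complementIf-half (c u) (c w) u w) in from , to
    }
    where
    τ : Bits (2 * k) → Bits (2 * k)
    τ x = complementIf (c x) x
    τ-involutive : ∀ x → τ (τ x) ≡ x
    τ-involutive x with c x in cx
    ... | false rewrite cx = refl
    ... | true  rewrite c-⊕𝟏 x | cx = ⊕𝟏-involutive x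

  module _ (S : VSubset k) where

    avoidsPair : Bits (2 * k) → Bool
    avoidsPair x = not (S x ∨ S (x ⊕ 𝟏))

    complementAvoidedPairs : Aut k
    complementAvoidedPairs = complementing avoidsPair avoidsPair-⊕𝟏
      where
      avoidsPair-⊕𝟏 : ∀ x → avoidsPair (x ⊕ 𝟏) ≡ avoidsPair x
      avoidsPair-⊕𝟏 x rewrite ⊕𝟏-involutive x = cong not (∨-comm (S (x ⊕ 𝟏)) (S x))

    complementAvoidedPairs-fixes : ∀ v → Mem k v S → Aut.σ complementAvoidedPairs v ≡ v
    complementAvoidedPairs-fixes v v∈S rewrite v∈S = refl

    complementAvoidedPairs-flips : ∀ u → S u ≡ false → S (u ⊕ 𝟏) ≡ false →
      Aut.σ complementAvoidedPairs u ≡ u ⊕ 𝟏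
    complementAvoidedPairs-flips u u∉S ū∉S rewrite u∉S | ū∉S = refl

module _ {k : ℕ} (φ : Aut k) where
  open Aut φ
  open Inverse perm using (from; strictlyInverseˡ)

  σ-injective : {v w : Bits (2 * k)} → σ v ≡ σ w → v ≡ w
  σ-injective = Injection.injective (Inverse⇒Injection perm)

  σ-preserves-neighbourhood-⊆ : {v w : Bits (2 * k)} → (∀ x → Adj k v x → Adj k w x) →
    ∀ y → Adj k (σ v) y → Adj k (σ w) y
  σ-preserves-neighbourhood-⊆ {v} {w} N⊆N y σv~y =
    subst (Adj k (σ w)) σx≡y
      (to-adj w x (N⊆N x (from-adj v x (subst (Adj k (σ v)) (sym σx≡y) σv~y))))
    where
    x : Bits (2 * k)
    x = from y
    σx≡y : σ x ≡ y
    σx≡y = strictlyInverseˡ y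
    to-adj : ∀ u x → Adj k u x → Adj k (σ u) (σ x)
    to-adj u x = proj₁ (preserves u x)
    from-adj : ∀ u x → Adj k (σ u) (σ x) → Adj k u x
    from-adj u x = proj₂ (preserves u x)

module _ {k : ℕ} where
  open HalfDistance {k = suc k} (2*k≡k+k (suc k))

  -- The neighbourhoods of v and v ⊕ 𝟏 coincide, so σ (v ⊕ 𝟏) shares the neighbourhood of σ v.
  σ-⊕𝟏 : (φ : Aut (suc k)) (v : Bits (2 * suc k)) → Aut.σ φ (v ⊕ 𝟏) ≡ Aut.σ φ v ⊕ 𝟏
  σ-⊕𝟏 φ v
    with neighbourhood-⊆⇒≡⊎≡⊕𝟏 (σ v) (σ (v ⊕ 𝟏))
           (σ-preserves-neighbourhood-⊆ φ λ x → Equivalence.from (dist-complementIf-half true false v x))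
    where open Aut φ
  ... | inj₁ σv̄≡σv = ⊥-elim (⊕𝟏-fixedPointFree v (σ-injective φ σv̄≡σv))
  ... | inj₂ σv̄≡σv⊕𝟏 = σv̄≡σv⊕𝟏

  meetsEveryAntipodalPair⇒determining : (S : VSubset (suc k)) →
    MeetsEveryAntipodalPair S → IsDetermining (suc k) S
  meetsEveryAntipodalPair⇒determining S meets φ fixes v with meets v
  ... | inj₁ v∈S = fixes v v∈S
  ... | inj₂ v̄∈S = ⊕𝟏-injective (trans (sym (σ-⊕𝟏 φ v)) (fixes (v ⊕ 𝟏) v̄∈S))

  determining⇒meetsEveryAntipodalPair : (S : VSubset (suc k)) →
    IsDetermining (suc k) S → MeetsEveryAntipodalPair S
  determining⇒meetsEveryAntipodalPair S determining u with S u in u∈?S | S (u ⊕ 𝟏) in ū∈?S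
  ... | true  | _     = inj₁ refl
  ... | false | true  = inj₂ refl
  ... | false | false = ⊥-elim (⊕𝟏-fixedPointFree u (begin
    u ⊕ 𝟏    ≡⟨ complementAvoidedPairs-flips (suc k) S u u∈?S ū∈?S ⟨
    Aut.σ τ u ≡⟨ determining τ (complementAvoidedPairs-fixes (suc k) S) u ⟩
    u        ∎))
    where
    open ≡-Reasoning
    τ : Aut (suc k)
    τ = complementAvoidedPairs (suc k) S

count : (n : ℕ) → (Bits n → Bool) → ℕ
count n p = length (filterᵇ p (allBits n))

length-filterᵇ-map : {A B : Set} (p : B → Bool) (f : A → B) (xs : List A) →
  length (filterᵇ p (map f xs)) ≡ length (filterᵇ (p ∘ f) xs)
length-filterᵇ-map p f List.[] = refl
length-filterᵇ-map p f (x List.∷ xs) with p (f x)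
... | true  = cong suc (length-filterᵇ-map p f xs)
... | false = length-filterᵇ-map p f xs

count-suc : ∀ n (p : Bits (suc n) → Bool) →
  count (suc n) p ≡ count n (p ∘ (false ∷_)) + count n (p ∘ (true ∷_))
count-suc n p = begin
  length (filterᵇ p (map (false ∷_) bs ++ map (true ∷_) bs))
    ≡⟨ cong length (filter-++ (T? ∘ p) (map (false ∷_) bs) (map (true ∷_) bs)) ⟩
  length (filterᵇ p (map (false ∷_) bs) ++ filterᵇ p (map (true ∷_) bs))
    ≡⟨ length-++ (filterᵇ p (map (false ∷_) bs)) ⟩
  length (filterᵇ p (map (false ∷_) bs)) + length (filterᵇ p (map (true ∷_) bs))
    ≡⟨ cong₂ _+_ (length-filterᵇ-map p (false ∷_) bs) (length-filterᵇ-map p (true ∷_) bs) ⟩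
  count n (p ∘ (false ∷_)) + count n (p ∘ (true ∷_)) ∎
  where
  open ≡-Reasoning
  bs : List (Bits n)
  bs = allBits n

count-true : ∀ n → count n (const true) ≡ 2 ^ n
count-true zero    = refl
count-true (suc n) = begin
  count (suc n) (const true)                  ≡⟨ count-suc n (const true) ⟩
  count n (const true) + count n (const true) ≡⟨ cong₂ _+_ (count-true n) (count-true n) ⟩
  2 ^ n + 2 ^ n                               ≡⟨ cong (2 ^ n +_) (+-identityʳ (2 ^ n)) ⟨
  2 ^ suc n                                   ∎
  where open ≡-Reasoning

count-false : ∀ n → count n (const false) ≡ 0
count-false zero    = refl
count-false (suc n) = trans (count-suc n (const false)) (cong₂ _+_ (count-false n) (count-false n))

count-∘⊕𝟏 : ∀ n (p : Bits n → Bool) → count n (p ∘ (_⊕ 𝟏)) ≡ count n p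
count-∘⊕𝟏 zero p with p []
... | true  = refl
... | false = refl
count-∘⊕𝟏 (suc n) p = begin
  count (suc n) (p ∘ (_⊕ 𝟏))
    ≡⟨ count-suc n (p ∘ (_⊕ 𝟏)) ⟩
  count n (p ∘ (true ∷_) ∘ (_⊕ 𝟏)) + count n (p ∘ (false ∷_) ∘ (_⊕ 𝟏))
    ≡⟨ cong₂ _+_ (count-∘⊕𝟏 n (p ∘ (true ∷_))) (count-∘⊕𝟏 n (p ∘ (false ∷_))) ⟩
  count n (p ∘ (true ∷_)) + count n (p ∘ (false ∷_))
    ≡⟨ +-comm (count n (p ∘ (true ∷_))) _ ⟩
  count n (p ∘ (false ∷_)) + count n (p ∘ (true ∷_))
    ≡⟨ count-suc n p ⟨
  count (suc n) p ∎
  where open ≡-Reasoning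

count-cover : ∀ n (p q : Bits n → Bool) → (∀ w → p w ≡ true ⊎ q w ≡ true) →
  2 ^ n ≤ count n p + count n q
count-cover zero p q cover with p [] | q [] | cover []
... | true  | _    | _ = s≤s z≤n
... | false | true | _ = s≤s z≤n
... | false | false | inj₁ ()
... | false | false | inj₂ ()
count-cover (suc n) p q cover = begin
  2 ^ suc n
    ≡⟨ cong (2 ^ n +_) (+-identityʳ (2 ^ n)) ⟩
  2 ^ n + 2 ^ n
    ≤⟨ +-mono-≤ (count-cover n p₀ q₀ (cover ∘ (false ∷_))) (count-cover n p₁ q₁ (cover ∘ (true ∷_))) ⟩
  (count n p₀ + count n q₀) + (count n p₁ + count n q₁)
    ≡⟨ interchange (count n p₀) (count n q₀) (count n p₁) (count n q₁) ⟩
  (count n p₀ + count n p₁) + (count n q₀ + count n q₁)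
    ≡⟨ cong₂ _+_ (count-suc n p) (count-suc n q) ⟨
  count (suc n) p + count (suc n) q ∎
  where
  open ≤-Reasoning
  p₀ p₁ q₀ q₁ : Bits n → Bool
  p₀ = p ∘ (false ∷_)
  p₁ = p ∘ (true ∷_)
  q₀ = q ∘ (false ∷_)
  q₁ = q ∘ (true ∷_)

meetsEveryAntipodalPair⇒2^n≤count : (S : Bits (suc n) → Bool) →
  MeetsEveryAntipodalPair S → 2 ^ n ≤ count (suc n) S
meetsEveryAntipodalPair⇒2^n≤count {n} S meets = begin
  2 ^ n                                 ≤⟨ count-cover n S₀ (S₁ ∘ (_⊕ 𝟏)) (meets ∘ (false ∷_)) ⟩
  count n S₀ + count n (S₁ ∘ (_⊕ 𝟏))   ≡⟨ cong (count n S₀ +_) (count-∘⊕𝟏 n S₁) ⟩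
  count n S₀ + count n S₁               ≡⟨ count-suc n S ⟨
  count (suc n) S                       ∎
  where
  open ≤-Reasoning
  S₀ S₁ : Bits n → Bool
  S₀ = S ∘ (false ∷_)
  S₁ = S ∘ (true ∷_)

headFalse : Bits (suc n) → Bool
headFalse = not ∘ head

headFalse-meetsEveryAntipodalPair : MeetsEveryAntipodalPair (headFalse {n})
headFalse-meetsEveryAntipodalPair (false ∷ _) = inj₁ refl
headFalse-meetsEveryAntipodalPair (true ∷ _)  = inj₂ refl

count-headFalse : ∀ n → count (suc n) headFalse ≡ 2 ^ n
count-headFalse n = begin
  count (suc n) headFalse                       ≡⟨ count-suc n headFalse ⟩
  count n (const true) + count n (const false)  ≡⟨ cong₂ _+_ (count-true n) (count-false n) ⟩
  2 ^ n + 0                                     ≡⟨ +-identityʳ (2 ^ n) ⟩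
  2 ^ n                                         ∎
  where open ≡-Reasoning

theorem2 : (k : ℕ) → k ≥ 1 →
    ((S : VSubset k) → IsDetermining k S ⇔ (∀ u → Mem k u S ⊎ Mem k (u ⊕ 𝟏) S))
    × DetIs k (2 ^ (2 * k ∸ 1))
theorem2 (suc k) _ =
    (λ S → mk⇔ (determining⇒meetsEveryAntipodalPair S) (meetsEveryAntipodalPair⇒determining S))
  , ( (headFalse , meetsEveryAntipodalPair⇒determining headFalse headFalse-meetsEveryAntipodalPair
                 , count-headFalse (2 * suc k ∸ 1))
    , λ S determining →
        meetsEveryAntipodalPair⇒2^n≤count S (determining⇒meetsEveryAntipodalPair S determining))
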